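{- For every integer $n\ge 8$, let $k=\lfloor (n-8)/3\rfloor$. There is a pair of trees, each with at most $n$ vertices, such that no minimum $k$-isometric-universal graph for this pair is a tree. Consequently $k^*(n)>\lfloor (n-8)/3\rfloor$, where $k^*(n)$ denotes the smallest integer such that for every $k'\ge k^*(n)$, every minimum and minimal $k'$-isometric-universal graph for a pair of trees each with at most $n$ vertices is a tree.
   Context: For vertices $u,v$ of a graph $G$, $\mathrm{dist}_G(u,v)$ is the number of edges of a shortest $u$–$v$ path, and $\infty$ if no such path exists. For an integer $k\ge 0$, a subgraph $H$ of $G$ is $k$-isometric if for all vertices $u,v$ of $H$ with $\mathrm{dist}_G(u,v)\le k$ we have $\mathrm{dist}_H(u,v)=\mathrm{dist}_G(u,v)$. A graph $\mathcal{U}$ is a $k$-isometric-universal graph for a family $\mathcal{F}$ if every graph of $\mathcal{F}$ is isomorphic to a $k$-isometric subgraph of $\mathcal{U}$; it is minimum if it has the fewest vertices among all $k$-isometric-universal graphs for $\mathcal{F}$, and minimal if no proper subgraph of it is $k$-isometric-universal for $\mathcal{F}$. -}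

module Defs where

open import Level using (0ℓ)
open import Data.Nat using (ℕ; zero; suc; _≤_; _<_; _∸_; _/_)
open import Data.Fin using (Fin; inject₁; fromℕ) renaming (zero to fzero; suc to fsuc)
open import Data.Product using (Σ; ∃; _×_; _,_)
open import Data.Sum using (_⊎_)
open import Relation.Nullary using (¬_)
open import Relation.Binary.PropositionalEquality using (_≡_)
open import Function.Definitions using (Injective; Surjective)

record Graph : Set₁ where
  field
    size  : ℕ
    Adj   : Fin size → Fin size → Set
    sym   : ∀ {u v} → Adj u v → Adj v u
    irrefl : ∀ {u} → ¬ Adj u u
open Graph public

data Walk (G : Graph) : Fin (size G) → Fin (size G) → ℕ → Set where
  here : ∀ {u} → Walk G u u 0
  step : ∀ {u w v d} → Adj G u w → Walk G w v d → Walk G u v (suc d)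

Dist : (G : Graph) → Fin (size G) → Fin (size G) → ℕ → Set
Dist G u v d = Walk G u v d × (∀ d′ → d′ < d → ¬ Walk G u v d′)

Connected : Graph → Set
Connected G = ∀ u v → ∃ λ d → Walk G u v d

-- A cycle of length l+3: injective cyclic sequence of adjacent vertices.
Cycle : (G : Graph) → ℕ → Set
Cycle G l = Σ (Fin (suc (suc (suc l))) → Fin (size G)) λ c →
  Injective _≡_ _≡_ c
  × (∀ (i : Fin (suc (suc l))) → Adj G (c (inject₁ i)) (c (fsuc i)))
  × Adj G (c (fromℕ (suc (suc l)))) (c fzero)

Acyclic : Graph → Set
Acyclic G = ∀ l → ¬ Cycle G l

IsTree : Graph → Set
IsTree G = 1 ≤ size G × Connected G × Acyclic G

-- f : V(H) → V(G) exhibits H as isomorphic to a subgraph of G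
-- (namely the image of H): f injective and edge-preserving.
record SubgraphEmbedding (H G : Graph) : Set where
  field
    map   : Fin (size H) → Fin (size G)
    inj   : Injective _≡_ _≡_ map
    hom   : ∀ {u v} → Adj H u v → Adj G (map u) (map v)
open SubgraphEmbedding public

-- H is isomorphic to a k-isometric subgraph of G: the image subgraph
-- satisfies dist_image(x,y) = dist_G(x,y) whenever dist_G(x,y) ≤ k.
KIsometricEmbedding : ℕ → Graph → Graph → Set
KIsometricEmbedding k H G = Σ (SubgraphEmbedding H G) λ e →
  ∀ u v d → Dist G (map e u) (map e v) d → d ≤ k → Dist H u v d

UniversalPair : ℕ → Graph → Graph → Graph → Set
UniversalPair k T₁ T₂ U = KIsometricEmbedding k T₁ U × KIsometricEmbedding k T₂ U

MinimumUniversalPair : ℕ → Graph → Graph → Graph → Set₁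
MinimumUniversalPair k T₁ T₂ U =
  UniversalPair k T₁ T₂ U × (∀ U′ → UniversalPair k T₁ T₂ U′ → size U ≤ size U′)

Proper : ∀ {S U} → SubgraphEmbedding S U → Set
Proper {S} {U} e =
  ¬ (Surjective _≡_ _≡_ (map e)
     × (∀ x y → Adj U x y → ∃ λ u → ∃ λ v → map e u ≡ x × map e v ≡ y × Adj S u v))

MinimalUniversalPair : ℕ → Graph → Graph → Graph → Set₁
MinimalUniversalPair k T₁ T₂ U =
  UniversalPair k T₁ T₂ U ×
  (∀ S (e : SubgraphEmbedding S U) → Proper e → ¬ UniversalPair k T₁ T₂ S)

-- P(n,k): for every k′ ≥ k, every minimum and minimal k′-isometric-universal
-- graph for a pair of trees with at most n vertices each is a tree.
-- k*(n) is the least k with P(n,k); so k*(n) > k  iff  ¬ P(n,k)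
-- (P is upward closed in k).
TreeUniversalityFrom : ℕ → ℕ → Set₁
TreeUniversalityFrom n k = ∀ k′ → k ≤ k′ → ∀ T₁ T₂ → IsTree T₁ → IsTree T₂ →
  size T₁ ≤ n → size T₂ ≤ n → ∀ U →
  MinimumUniversalPair k′ T₁ T₂ U → MinimalUniversalPair k′ T₁ T₂ U → IsTree U

{-# OPTIONS --safe #-}
-- T₁ and T₂ are double brooms: paths of length k + 1 and k + 2 with k + 2 leaves at each end. Closing the
-- spine of T₂ into a cycle by a new path of length k + 1 between its hubs gives a graph W on 4k + 7 vertices
-- containing both k-isometrically: T₂ because a walk of length ≤ k cannot run around the new path, and T₁,
-- lying on the other arc of the cycle, because W retracts onto it.
-- A tree U containing both has at least 4k + 8 vertices. Its unique path between the images of T₂'s hubs has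
-- length k + 2, so the hubs cannot both lie on the image of T₁'s spine, of length k + 1; a hub lying outside
-- T₁ or on a leaf of T₁ has at most one of its k + 3 neighbours in T₁, whence |U| ≥ |T₁| + k + 2.
-- So no minimum universal graph is a tree, and a minimum one with fewest edges is also minimal.
module Submission where

open import Defs renaming (sym to Adj-sym; irrefl to Adj-irrefl)
open import Data.Nat using (ℕ; zero; suc; _+_; _*_; _∸_; _/_; _≤_; _<_; _<?_; z≤n; s≤s)
open import Data.Nat.DivMod using (m/n*n≤m)
open import Data.Nat.Tactic.RingSolver using (solve-∀)
open import Data.Nat.Properties
  using ( ≤-refl; ≤-reflexive; ≤-trans; ≤-antisym; ≤-total; ≤-pred; <-irrefl; ≮⇒≥; 1+n≰n; 1+n≢n; n≤1+n
        ; m≤n⇒m≤1+n; m<n⇒m<1+n; m≤n⇒m<n∨m≡n; n≤0⇒n≡0; m≤m+n; suc-injective; +-suc; +-identityʳ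
        ; +-monoˡ-≤; +-monoʳ-≤; +-mono-≤; +-mono-<-≤; +-mono-≤-<; m∸n≤m; m∸n+n≡m; m+n∸n≡m; m+[n∸m]≡n
        ; ∸-monoʳ-≤; +-0-monoid )
open import Data.Nat.Induction using (<-rec)
open import Algebra.Properties.Monoid.Sum +-0-monoid using (sum)
open import Data.Fin using (Fin; toℕ; inject₁; fromℕ; fromℕ<; pred; punchIn; punchOut; join; splitAt; _≟_)
  renaming (zero to fzero; suc to fsuc)
open import Data.Fin.Properties
  using ( toℕ-inject₁; toℕ-injective; toℕ-fromℕ; toℕ-fromℕ<; toℕ≤pred[n]; +↔⊎; join-splitAt
        ; punchIn-injective; punchInᵢ≢i; punchOut-injective; injective⇒≤; any? )
  renaming (suc-injective to suc-injectiveᶠ)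
open import Data.Fin.Relation.Unary.Top using (view; ‵fromℕ; ‵inj₁)
open import Data.List using (allFin)
open import Data.List.Extrema.Nat using (argmax; f[xs]≤f[argmax])
open import Data.List.Membership.Propositional.Properties using (∈-allFin)
import Data.List.Relation.Unary.All as All
open import Data.Product using (Σ; ∃; ∃₂; _×_; _,_; proj₁; proj₂)
open import Data.Sum using (_⊎_; inj₁; inj₂; [_,_])
import Data.Sum as Sum
import Data.Product as Product
open import Function.Bundles using (_↔_; Inverse)
open import Function.Properties.Inverse using (↔-refl; ↔-sym; ↔-trans)
open import Data.Sum.Function.Propositional using (_⊎-↔_)
open import Data.Empty using (⊥)
open import Data.Unit using (⊤; tt)
open import Function using (id; _∘_; case_of_)
open import Function.Definitions using (Injective)
open import Relation.Nullary using (¬_; Dec; yes; no; contradiction)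
open import Relation.Nullary.Decidable using (_⊎-dec_; ¬¬-excluded-middle; decidable-stable)
open import Relation.Binary.PropositionalEquality
  using (_≡_; _≢_; refl; sym; trans; cong; subst; subst₂)

private
  variable
    G H : Graph
    d d₁ d₂ l : ℕ

Walk≤ : (G : Graph) → Fin (size G) → Fin (size G) → ℕ → Set
Walk≤ G u v d = Σ ℕ λ d′ → d′ ≤ d × Walk G u v d′

module _ {G : Graph} where

  infix 4 _∈ʷ_ _∉ʷ_ _∈ʷ?_

  _∈ʷ_ : ∀ {u v} → Fin (size G) → Walk G u v d → Set
  x ∈ʷ here {u} = x ≡ u
  x ∈ʷ step {u} _ p = x ≡ u ⊎ x ∈ʷ p

  _∉ʷ_ : ∀ {u v} → Fin (size G) → Walk G u v d → Set
  x ∉ʷ p = ¬ x ∈ʷ p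

  _∈ʷ?_ : ∀ {u v} x (p : Walk G u v d) → Dec (x ∈ʷ p)
  x ∈ʷ? here {u} = x ≟ u
  x ∈ʷ? step {u} _ p = x ≟ u ⊎-dec x ∈ʷ? p

  IsPath : ∀ {u v} → Walk G u v d → Set
  IsPath here = ⊤
  IsPath (step {u} _ p) = u ∉ʷ p × IsPath p

  end-∈ʷ : ∀ {u v} (p : Walk G u v d) → v ∈ʷ p
  end-∈ʷ here = refl
  end-∈ʷ (step _ p) = inj₂ (end-∈ʷ p)

  infixr 5 _++ʷ_
  infixl 5 _∷ʳʷ_

  _++ʷ_ : ∀ {u v w} → Walk G u v d₁ → Walk G v w d₂ → Walk G u w (d₁ + d₂)
  here ++ʷ q = q
  step a p ++ʷ q = step a (p ++ʷ q)

  ∈ʷ-++⁻ : ∀ {u v w x} (p : Walk G u v d₁) (q : Walk G v w d₂) → x ∈ʷ p ++ʷ q → x ∈ʷ p ⊎ x ∈ʷ q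
  ∈ʷ-++⁻ here q x∈q = inj₂ x∈q
  ∈ʷ-++⁻ (step _ p) q (inj₁ x≡u) = inj₁ (inj₁ x≡u)
  ∈ʷ-++⁻ (step _ p) q (inj₂ x∈) = [ inj₁ ∘ inj₂ , inj₂ ] (∈ʷ-++⁻ p q x∈)

  _∷ʳʷ_ : ∀ {u v w} → Walk G u v d → Adj G v w → Walk G u w (suc d)
  here ∷ʳʷ a = step a here
  step a′ p ∷ʳʷ a = step a′ (p ∷ʳʷ a)

  ∈ʷ-∷ʳ⁻ : ∀ {u v w x} (p : Walk G u v d) (a : Adj G v w) → x ∈ʷ p ∷ʳʷ a → x ∈ʷ p ⊎ x ≡ w
  ∈ʷ-∷ʳ⁻ here a (inj₁ x≡u) = inj₁ x≡u
  ∈ʷ-∷ʳ⁻ here a (inj₂ x≡w) = inj₂ x≡w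
  ∈ʷ-∷ʳ⁻ (step _ p) a (inj₁ x≡u) = inj₁ (inj₁ x≡u)
  ∈ʷ-∷ʳ⁻ (step _ p) a (inj₂ x∈) = [ inj₁ ∘ inj₂ , inj₂ ] (∈ʷ-∷ʳ⁻ p a x∈)

  reverseʷ : ∀ {u v} → Walk G u v d → Walk G v u d
  reverseʷ here = here
  reverseʷ (step a p) = reverseʷ p ∷ʳʷ Adj-sym G a

  ∈ʷ-reverse⁻ : ∀ {u v x} (p : Walk G u v d) → x ∈ʷ reverseʷ p → x ∈ʷ p
  ∈ʷ-reverse⁻ here x∈ = x∈
  ∈ʷ-reverse⁻ (step a p) x∈ = [ inj₂ ∘ ∈ʷ-reverse⁻ p , inj₁ ] (∈ʷ-∷ʳ⁻ (reverseʷ p) (Adj-sym G a) x∈)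

  reverse≤ : ∀ {u v} → Walk≤ G u v d → Walk≤ G v u d
  reverse≤ (d′ , d′≤d , p) = d′ , d′≤d , reverseʷ p

  record PathIn {u v} (w : Walk G u v d) (x : Fin (size G)) : Set where
    field
      length  : ℕ
      length≤ : length ≤ d
      path    : Walk G x v length
      isPath  : IsPath path
      ⊆w      : ∀ {y} → y ∈ʷ path → y ∈ʷ w

  open PathIn

  PathIn-step : ∀ {u′ u v x} {a : Adj G u′ u} {w : Walk G u v d} → PathIn w x → PathIn (step a w) x
  PathIn-step r = record { length = length r ; length≤ = m≤n⇒m≤1+n (length≤ r) ; path = path r
                         ; isPath = isPath r ; ⊆w = inj₂ ∘ ⊆w r }

  PathIn-trans : ∀ {u v x y} {w : Walk G u v d} (r : PathIn w x) → PathIn (path r) y → PathIn w y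
  PathIn-trans r s = record { length = length s ; length≤ = ≤-trans (length≤ s) (length≤ r) ; path = path s
                            ; isPath = isPath s ; ⊆w = ⊆w r ∘ ⊆w s }

  path-suffix : ∀ {u v x} (p : Walk G u v d) → IsPath p → x ∈ʷ p → PathIn p x
  path-suffix here _ refl = record { length = 0 ; length≤ = z≤n ; path = here ; isPath = tt ; ⊆w = id }
  path-suffix p@(step _ _) p-path (inj₁ refl) =
    record { length = _ ; length≤ = ≤-refl ; path = p ; isPath = p-path ; ⊆w = id }
  path-suffix (step _ p) (_ , p-path) (inj₂ x∈p) = PathIn-step (path-suffix p p-path x∈p)

  walk⇒path : ∀ {u v} (w : Walk G u v d) → PathIn w u
  walk⇒path here = record { length = 0 ; length≤ = z≤n ; path = here ; isPath = tt ; ⊆w = id }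
  walk⇒path (step {u} a w) with r ← walk⇒path w | u ∈ʷ? path r
  ... | yes u∈r = PathIn-step (PathIn-trans r (path-suffix (path r) (isPath r) u∈r))
  ... | no u∉r = record { length = suc (length r) ; length≤ = s≤s (length≤ r) ; path = step a (path r)
                        ; isPath = u∉r , isPath r ; ⊆w = [ inj₁ , inj₂ ∘ ⊆w r ] }

  walkVertex : ∀ {u v} → Walk G u v d → Fin (suc d) → Fin (size G)
  walkVertex (here {u}) _ = u
  walkVertex (step {u} _ p) fzero = u
  walkVertex (step _ p) (fsuc i) = walkVertex p i

  walkVertex-adjacent : ∀ {u v} (p : Walk G u v d) (i : Fin d) →
                        Adj G (walkVertex p (inject₁ i)) (walkVertex p (fsuc i))
  walkVertex-adjacent (step a here) fzero = a
  walkVertex-adjacent (step a (step _ _)) fzero = a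
  walkVertex-adjacent (step _ p) (fsuc i) = walkVertex-adjacent p i

  walkVertex-last : ∀ {u v} (p : Walk G u v d) → walkVertex p (fromℕ d) ≡ v
  walkVertex-last here = refl
  walkVertex-last (step _ p) = walkVertex-last p

  walkVertex-∈ʷ : ∀ {u v} (p : Walk G u v d) i → walkVertex p i ∈ʷ p
  walkVertex-∈ʷ here _ = refl
  walkVertex-∈ʷ (step _ p) fzero = inj₁ refl
  walkVertex-∈ʷ (step _ p) (fsuc i) = inj₂ (walkVertex-∈ʷ p i)

  walkVertex-injective : ∀ {u v} (p : Walk G u v d) → IsPath p → Injective _≡_ _≡_ (walkVertex p)
  walkVertex-injective here _ {fzero} {fzero} _ = refl
  walkVertex-injective (step _ p) _ {fzero} {fzero} _ = refl
  walkVertex-injective (step _ p) (u∉p , _) {fzero} {fsuc j} u≡ =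
    contradiction (subst (_∈ʷ p) (sym u≡) (walkVertex-∈ʷ p j)) u∉p
  walkVertex-injective (step _ p) (u∉p , _) {fsuc i} {fzero} ≡u =
    contradiction (subst (_∈ʷ p) ≡u (walkVertex-∈ʷ p i)) u∉p
  walkVertex-injective (step _ p) (_ , p-path) {fsuc i} {fsuc j} eq = cong fsuc (walkVertex-injective p p-path eq)

  closed-path⇒cycle : ∀ {u v} (p : Walk G u v (suc (suc l))) → IsPath p → Adj G v u → Cycle G l
  closed-path⇒cycle p@(step _ q) p-path a =
    walkVertex p , walkVertex-injective p p-path , walkVertex-adjacent p ,
    subst (λ z → Adj G z _) (sym (walkVertex-last q)) a

  module _ (acyclic : Acyclic G) where

    acyclic⇒path-joined-neighbours-≡ : ∀ {u w₁ w₂} → Adj G u w₁ → Adj G u w₂ →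
                                       (r : Walk G w₁ w₂ d) → IsPath r → u ∉ʷ r → w₁ ≡ w₂
    acyclic⇒path-joined-neighbours-≡ a₁ a₂ here _ _ = refl
    acyclic⇒path-joined-neighbours-≡ a₁ a₂ r@(step _ _) r-path u∉r =
      contradiction (Adj-sym G a₂) (acyclic _ ∘ closed-path⇒cycle (step a₁ r) (u∉r , r-path))

    acyclic⇒joined-neighbours-≡ : ∀ {u w₁ w₂} → Adj G u w₁ → Adj G u w₂ →
                                  (r : Walk G w₁ w₂ d) → u ∉ʷ r → w₁ ≡ w₂
    acyclic⇒joined-neighbours-≡ a₁ a₂ r u∉r with s ← walk⇒path r =
      acyclic⇒path-joined-neighbours-≡ a₁ a₂ (path s) (isPath s) (u∉r ∘ ⊆w s)

    acyclic⇒path-length-unique : ∀ {u v} (p : Walk G u v d₁) (q : Walk G u v d₂) →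
                                 IsPath p → IsPath q → d₁ ≡ d₂
    acyclic⇒path-length-unique here here _ _ = refl
    acyclic⇒path-length-unique here (step _ q) _ (u∉q , _) = contradiction (end-∈ʷ q) u∉q
    acyclic⇒path-length-unique (step _ p) here (u∉p , _) _ = contradiction (end-∈ʷ p) u∉p
    acyclic⇒path-length-unique (step a₁ p) (step a₂ q) (u∉p , p-path) (u∉q , q-path)
      with refl ← acyclic⇒joined-neighbours-≡ a₁ a₂ (p ++ʷ reverseʷ q)
                    ([ u∉p , u∉q ∘ ∈ʷ-reverse⁻ q ] ∘ ∈ʷ-++⁻ p (reverseʷ q))
      = cong suc (acyclic⇒path-length-unique p q p-path q-path)

    acyclic⇒path-shortest : ∀ {u v} (p : Walk G u v d₁) → IsPath p → Walk G u v d₂ → d₁ ≤ d₂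
    acyclic⇒path-shortest p p-path w with r ← walk⇒path w =
      subst (_≤ _) (sym (acyclic⇒path-length-unique p (path r) p-path (isPath r))) (length≤ r)

Walk≤-weaken : ∀ {u v} → d₁ ≤ d₂ → Walk≤ G u v d₁ → Walk≤ G u v d₂
Walk≤-weaken d₁≤d₂ (d , d≤d₁ , p) = d , ≤-trans d≤d₁ d₁≤d₂ , p

stepwise-walk : (f : ℕ → Fin (size G)) → (∀ n → f n ≡ f (suc n) ⊎ Adj G (f n) (f (suc n))) →
                ∀ n m → Walk≤ G (f n) (f (m + n)) m
stepwise-walk f f-step n zero = 0 , z≤n , here
stepwise-walk {G} f f-step n (suc m) with d , d≤m , p ← stepwise-walk f f-step n m | f-step (m + n)
... | inj₁ eq = d , m≤n⇒m≤1+n d≤m , subst (λ v → Walk G (f n) v d) eq p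
... | inj₂ a = suc d , s≤s d≤m , p ∷ʳʷ a

Neighbours : (G : Graph) → Fin (size G) → ℕ → Set
Neighbours G h m = Σ (Fin m → Fin (size G)) λ nb → Injective _≡_ _≡_ nb × (∀ i → Adj G h (nb i))

EdgePreserving : (H G : Graph) → (Fin (size H) → Fin (size G)) → Set
EdgePreserving H G f = ∀ {a b} → Adj H a b → Adj G (f a) (f b)

module _ {H G : Graph} (f : Fin (size H) → Fin (size G)) (f-hom : EdgePreserving H G f) where

  mapʷ : ∀ {u v} → Walk H u v d → Walk G (f u) (f v) d
  mapʷ here = here
  mapʷ (step a p) = step (f-hom a) (mapʷ p)

  ∈ʷ-map⁻ : ∀ {u v x} (p : Walk H u v d) → x ∈ʷ mapʷ p → ∃ λ y → y ∈ʷ p × f y ≡ x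
  ∈ʷ-map⁻ here x≡ = _ , refl , sym x≡
  ∈ʷ-map⁻ (step _ p) (inj₁ x≡) = _ , inj₁ refl , sym x≡
  ∈ʷ-map⁻ (step _ p) (inj₂ x∈) with y , y∈p , fy≡x ← ∈ʷ-map⁻ p x∈ = y , inj₂ y∈p , fy≡x

  mapʷ-isPath : Injective _≡_ _≡_ f → ∀ {u v} (p : Walk H u v d) → IsPath p → IsPath (mapʷ p)
  mapʷ-isPath f-inj here _ = tt
  mapʷ-isPath f-inj (step _ p) (u∉p , p-path) = fu∉ , mapʷ-isPath f-inj p p-path
    where
    fu∉ : _ ∉ʷ mapʷ p
    fu∉ fu∈ with y , y∈p , fy≡fu ← ∈ʷ-map⁻ p fu∈ = u∉p (subst (_∈ʷ p) (f-inj fy≡fu) y∈p)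

embedʷ : ∀ {u v} (e : SubgraphEmbedding H G) → Walk H u v d → Walk G (map e u) (map e v) d
embedʷ e = mapʷ (map e) (hom e)

embedʷ-isPath : ∀ {u v} (e : SubgraphEmbedding H G) (p : Walk H u v d) → IsPath p → IsPath (embedʷ e p)
embedʷ-isPath e = mapʷ-isPath (map e) (hom e) (inj e)

embed-neighbours : ∀ {h m} (e : SubgraphEmbedding H G) → Neighbours H h m → Neighbours G (map e h) m
embed-neighbours e (nb , nb-inj , nb-adj) = map e ∘ nb , nb-inj ∘ inj e , hom e ∘ nb-adj

cycle-neighbours : (C : Cycle G l) (i : Fin (suc (suc (suc l)))) → let c = proj₁ C in
                   ∃₂ λ j₁ j₂ → j₁ ≢ j₂ × Adj G (c i) (c j₁) × Adj G (c i) (c j₂)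
cycle-neighbours {G} (c , _ , adj , close) i with view i
... | ‵fromℕ = _ , fzero , (λ ()) , Adj-sym G (adj (fromℕ _)) , close
... | ‵inj₁ {i = fzero} _ = fsuc fzero , fromℕ _ , (λ ()) , adj fzero , Adj-sym G close
... | ‵inj₁ {i = fsuc j} _ =
  inject₁ (inject₁ j) , fsuc (fsuc j) , apart , Adj-sym G (adj (inject₁ j)) , adj (fsuc j)
  where
  apart : inject₁ (inject₁ j) ≢ fsuc (fsuc j)
  apart eq = 1+n≰n (subst (suc (toℕ j) ≤_)
    (trans (sym (cong toℕ eq)) (trans (toℕ-inject₁ (inject₁ j)) (toℕ-inject₁ j))) (n≤1+n _))

record Layering (G : Graph) : Set where
  field
    level  : Fin (size G) → ℕ
    parent : Fin (size G) → Fin (size G)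
    edge   : ∀ {x y} → Adj G x y →
             (level y ≡ suc (level x) × parent y ≡ x) ⊎ (level x ≡ suc (level y) × parent x ≡ y)

module _ (L : Layering G) where
  open Layering L

  -- The two cycle neighbours of a vertex of maximal level on a cycle would both be its parent.
  cycle-has-no-top : (C : Cycle G l) (i : Fin (suc (suc (suc l)))) →
                     ¬ (∀ j → level (proj₁ C j) ≤ level (proj₁ C i))
  cycle-has-no-top C@(c , c-inj , _) i i-top with j₁ , j₂ , j₁≢j₂ , a₁ , a₂ ← cycle-neighbours {G} C i =
    j₁≢j₂ (c-inj (trans (sym (to-parent a₁)) (to-parent a₂)))
    where
    to-parent : ∀ {j} → Adj G (c i) (c j) → parent (c i) ≡ c j
    to-parent {j} a with edge a
    ... | inj₁ (up , _) = contradiction (subst (_≤ level (c i)) up (i-top j)) 1+n≰n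
    ... | inj₂ (_ , p) = p

  layering⇒acyclic : Acyclic G
  layering⇒acyclic l C@(c , _) =
    cycle-has-no-top C (argmax (level ∘ c) fzero (allFin _))
      (All.lookup (f[xs]≤f[argmax] {f = level ∘ c} fzero (allFin _)) ∘ ∈-allFin)

  level-step : ∀ {x y} → Adj G x y → level y ≤ suc (level x)
  level-step a with edge a
  ... | inj₁ (up , _) = ≤-reflexive up
  ... | inj₂ (down , _) = ≤-trans (n≤1+n _) (≤-trans (≤-reflexive (sym down)) (n≤1+n _))

  layering-walk-bound : ∀ {x y} → Walk G x y d → level y ≤ level x + d
  layering-walk-bound here = ≤-reflexive (sym (+-identityʳ _))
  layering-walk-bound {d = suc d} (step a p) =
    ≤-trans (layering-walk-bound p) (≤-trans (+-monoˡ-≤ d (level-step a)) (≤-reflexive (sym (+-suc _ d))))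

left-inverse⇒injective : ∀ {A B : Set} {f : A → B} (g : B → A) → (∀ x → g (f x) ≡ x) → Injective _≡_ _≡_ f
left-inverse⇒injective g g∘f≡id {x} {y} eq = trans (sym (g∘f≡id x)) (trans (cong g eq) (g∘f≡id y))

record PresentedGraph : Set₁ where
  infix 4 _~_
  field
    Vertex   : Set
    order    : ℕ
    coding   : Vertex ↔ Fin order
    _~_      : Vertex → Vertex → Set
    ~-sym    : ∀ {x y} → x ~ y → y ~ x
    ~-irrefl : ∀ {x} → ¬ x ~ x

  open Inverse coding public
    using ()
    renaming (to to encode; from to decode; strictlyInverseˡ to encode-decode; strictlyInverseʳ to decode-encode)

  graph : Graph
  graph = record { size = order ; Adj = λ i j → decode i ~ decode j ; sym = ~-sym ; irrefl = ~-irrefl }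

  encode-injective : Injective _≡_ _≡_ encode
  encode-injective = left-inverse⇒injective decode decode-encode

  decode-injective : Injective _≡_ _≡_ decode
  decode-injective = left-inverse⇒injective encode encode-decode

  encode-adj : ∀ {x y} → x ~ y → Adj graph (encode x) (encode y)
  encode-adj = subst₂ _~_ (sym (decode-encode _)) (sym (decode-encode _))

  encode-neighbours : ∀ {h m} (nb : Fin m → Vertex) → Injective _≡_ _≡_ nb → (∀ i → h ~ nb i) →
                      Neighbours graph (encode h) m
  encode-neighbours nb nb-inj nb-adj = encode ∘ nb , nb-inj ∘ encode-injective , encode-adj ∘ nb-adj

  layering : (level : Vertex → ℕ) (parent : Vertex → Vertex) →
             (∀ {x y} → x ~ y →
                (level y ≡ suc (level x) × parent y ≡ x) ⊎ (level x ≡ suc (level y) × parent x ≡ y)) →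
             Layering graph
  layering level parent edge = record
    { level  = level ∘ decode
    ; parent = encode ∘ parent ∘ decode
    ; edge   = λ a → Sum.map (Product.map₂ encode-≡) (Product.map₂ encode-≡) (edge a)
    }
    where
    encode-≡ : ∀ {x i} → x ≡ decode i → encode x ≡ i
    encode-≡ {i = i} eq = trans (cong encode eq) (encode-decode i)

presented-embedding : (g h : PresentedGraph) (φ : PresentedGraph.Vertex g → PresentedGraph.Vertex h) →
                      (∀ {x y} → PresentedGraph._~_ g x y → PresentedGraph._~_ h (φ x) (φ y)) →
                      Injective _≡_ _≡_ φ → SubgraphEmbedding (PresentedGraph.graph g) (PresentedGraph.graph h)
presented-embedding g h φ φ-hom φ-inj = record
  { map = encode h ∘ φ ∘ decode g
  ; inj = decode-injective g ∘ φ-inj ∘ encode-injective h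
  ; hom = encode-adj h ∘ φ-hom }
  where open PresentedGraph

short-walks⇒k-isometric : ∀ k (e : SubgraphEmbedding H G) →
                          (∀ u v d → Walk G (map e u) (map e v) d → d ≤ k → Walk≤ H u v d) →
                          KIsometricEmbedding k H G
short-walks⇒k-isometric {H} k e short = e , isometric
  where
  isometric : ∀ u v d → Dist _ (map e u) (map e v) d → d ≤ k → Dist H u v d
  isometric u v d (w , minimal) d≤k with short u v d w d≤k
  ... | d′ , d′≤d , w′ with m≤n⇒m<n∨m≡n d′≤d
  ...   | inj₁ d′<d = contradiction (embedʷ e w′) (minimal d′ d′<d)
  ...   | inj₂ refl = w′ , λ d″ d″<d → minimal d″ d″<d ∘ embedʷ e

WeakHom : (G H : Graph) → (Fin (size G) → Fin (size H)) → Set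
WeakHom G H r = ∀ {x y} → Adj G x y → r x ≡ r y ⊎ Adj H (r x) (r y)

weakHom-walk : ∀ {r x y} → WeakHom G H r → Walk G x y d → Walk≤ H (r x) (r y) d
weakHom-walk r-weak here = 0 , z≤n , here
weakHom-walk {H = H} {r = r} {y = y} r-weak (step a p) with d , d≤ , q ← weakHom-walk r-weak p | r-weak a
... | inj₁ eq = d , m≤n⇒m≤1+n d≤ , subst (λ x → Walk H x (r y) d) (sym eq) q
... | inj₂ a′ = suc d , s≤s d≤ , step a′ q

retraction⇒k-isometric : ∀ k (e : SubgraphEmbedding H G) (r : Fin (size G) → Fin (size H)) →
                         WeakHom G H r → (∀ u → r (map e u) ≡ u) → KIsometricEmbedding k H G
retraction⇒k-isometric {H} k e r r-weak r∘e≡id = short-walks⇒k-isometric k e λ u v d w _ →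
  subst₂ (λ x y → Walk≤ H x y d) (r∘e≡id u) (r∘e≡id v) (weakHom-walk r-weak w)

module _ (g h : PresentedGraph) where
  open PresentedGraph

  presented-retraction⇒k-isometric :
    ∀ k (φ : Vertex g → Vertex h) (ρ : Vertex h → Vertex g) →
    (∀ {x y} → _~_ g x y → _~_ h (φ x) (φ y)) →
    (∀ {x y} → _~_ h x y → ρ x ≡ ρ y ⊎ _~_ g (ρ x) (ρ y)) →
    (∀ x → ρ (φ x) ≡ x) → KIsometricEmbedding k (graph g) (graph h)
  presented-retraction⇒k-isometric k φ ρ φ-hom ρ-weak ρ∘φ≡id =
    retraction⇒k-isometric k (presented-embedding g h φ φ-hom (left-inverse⇒injective ρ ρ∘φ≡id))
      (encode g ∘ ρ ∘ decode h) (Sum.map (cong (encode g)) (encode-adj g) ∘ ρ-weak)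
      λ u → trans (cong (encode g ∘ ρ) (decode-encode h _))
                  (trans (cong (encode g) (ρ∘φ≡id _)) (encode-decode g u))

isometric-transport : ∀ {k T S S′} (φ : Fin (size S) → Fin (size S′)) (ψ : Fin (size S′) → Fin (size S)) →
                      EdgePreserving S S′ φ → EdgePreserving S′ S ψ → (∀ x → ψ (φ x) ≡ x) →
                      KIsometricEmbedding k T S → KIsometricEmbedding k T S′
isometric-transport {k} {T} {S} {S′} φ ψ φ-hom ψ-hom ψ∘φ≡id (e , isometric) = e′ , isometric′
  where
  e′ : SubgraphEmbedding T S′
  e′ = record { map = φ ∘ map e ; inj = inj e ∘ left-inverse⇒injective ψ ψ∘φ≡id ; hom = φ-hom ∘ hom e }

  isometric′ : ∀ u v d → Dist S′ (map e′ u) (map e′ v) d → d ≤ k → Dist T u v d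
  isometric′ u v d (w , minimal) = isometric u v d
    ( subst₂ (λ x y → Walk S x y d) (ψ∘φ≡id _) (ψ∘φ≡id _) (mapʷ ψ ψ-hom w)
    , λ d′ d′<d → minimal d′ d′<d ∘ mapʷ φ φ-hom )

∸-≤-suc-∸-suc : ∀ m n → m ∸ n ≤ suc (m ∸ suc n)
∸-≤-suc-∸-suc zero zero = z≤n
∸-≤-suc-∸-suc zero (suc n) = z≤n
∸-≤-suc-∸-suc (suc m) zero = ≤-refl
∸-≤-suc-∸-suc (suc m) (suc n) = ∸-≤-suc-∸-suc m n

-- g with an ear: a new path a, e₀, …, e_{k-1}, b of length k + 1 through fresh vertices e_j = inj₂ j
-- (a direct edge a b when k = 0).
module Ear (g : PresentedGraph) (a b : PresentedGraph.Vertex g) (a≢b : a ≢ b) (k : ℕ) where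
  open PresentedGraph g using (Vertex; _~_; ~-sym; ~-irrefl; encode; decode; encode-adj; encode-decode)
    renaming (graph to base)

  EarVertex : Set
  EarVertex = Vertex ⊎ Fin k

  infix 4 _⇢_ _≈_

  _⇢_ : EarVertex → EarVertex → Set
  inj₁ x ⇢ inj₁ y = k ≡ 0 × x ≡ a × y ≡ b
  inj₁ x ⇢ inj₂ j = x ≡ a × toℕ j ≡ 0
  inj₂ i ⇢ inj₂ j = suc (toℕ i) ≡ toℕ j
  inj₂ i ⇢ inj₁ y = y ≡ b × suc (toℕ i) ≡ k

  Old : EarVertex → EarVertex → Set
  Old (inj₁ x) (inj₁ y) = x ~ y
  Old _ _ = ⊥

  _≈_ : EarVertex → EarVertex → Set
  x ≈ y = Old x y ⊎ x ⇢ y ⊎ y ⇢ x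

  ≈-sym : ∀ {x y} → x ≈ y → y ≈ x
  ≈-sym {inj₁ _} {inj₁ _} (inj₁ x~y) = inj₁ (~-sym x~y)
  ≈-sym (inj₂ x⇢y) = inj₂ (Sum.swap x⇢y)

  ⇢-irrefl : ∀ {x} → ¬ x ⇢ x
  ⇢-irrefl {inj₁ x} (_ , refl , refl) = a≢b refl
  ⇢-irrefl {inj₂ i} eq = 1+n≢n eq

  ≈-irrefl : ∀ {x} → ¬ x ≈ x
  ≈-irrefl {inj₁ _} (inj₁ x~x) = ~-irrefl x~x
  ≈-irrefl (inj₂ x⇢x) = [ ⇢-irrefl , ⇢-irrefl ] x⇢x

  opaque
    coding : EarVertex ↔ Fin (PresentedGraph.order g + k)
    coding = ↔-sym (↔-trans +↔⊎ (↔-sym (PresentedGraph.coding g) ⊎-↔ ↔-refl))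

  presented : PresentedGraph
  presented = record
    { Vertex = EarVertex ; order = PresentedGraph.order g + k ; coding = coding
    ; _~_ = _≈_ ; ~-sym = ≈-sym ; ~-irrefl = ≈-irrefl }

  open PresentedGraph presented public using (graph)
  open PresentedGraph presented
    using () renaming (encode to encodeₑ; decode to decodeₑ; decode-encode to decode-encodeₑ)

  old-embedding : SubgraphEmbedding base graph
  old-embedding = presented-embedding g presented inj₁ inj₁ λ { refl → refl }

  -- A walk of length d from x to the vertex t of g yields a walk in g of length at most d, unless d > k;
  -- from e_j it yields one from a or from b, shorter by the j + 1 resp. k - j steps needed to get there.
  module Towards (t : Vertex) where

    Via : Vertex → ℕ → ℕ → Set
    Via x c d = Σ ℕ λ d′ → c + d′ ≤ d × Walk base (encode x) (encode t) d′

    Reach : EarVertex → ℕ → Set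
    Reach (inj₁ x) d = Via x 0 d ⊎ k < d
    Reach (inj₂ j) d = Via a (suc (toℕ j)) d ⊎ Via b (k ∸ toℕ j) d ⊎ k < d

    via-weaken : ∀ {x c c′ d} → c′ ≤ suc c → Via x c d → Via x c′ (suc d)
    via-weaken c′≤ (d′ , c+d′≤d , w) = d′ , ≤-trans (+-monoˡ-≤ d′ c′≤) (s≤s c+d′≤d) , w

    via-old : ∀ {x y d} → x ~ y → Via y 0 d → Via x 0 (suc d)
    via-old x~y (d′ , d′≤d , w) = suc d′ , s≤s d′≤d , step (encode-adj x~y) w

    via-far : ∀ {x c d} → k ≤ c → Via x c d → k < suc d
    via-far {c = c} k≤c (d′ , c+d′≤d , _) = s≤s (≤-trans k≤c (≤-trans (m≤m+n c d′) c+d′≤d))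

    k≡0⇒k< : ∀ {d} → k ≡ 0 → k < suc d
    k≡0⇒k< refl = s≤s z≤n

    reach-old : ∀ {x y d} → Old x y → Reach y d → Reach x (suc d)
    reach-old {inj₁ _} {inj₁ _} x~y = Sum.map (via-old x~y) m<n⇒m<1+n

    reach-forward : ∀ {x y d} → x ⇢ y → Reach y d → Reach x (suc d)
    reach-forward {inj₁ _} {inj₁ _} (k≡0 , _) _ = inj₂ (k≡0⇒k< k≡0)
    reach-forward {inj₁ _} {inj₂ j} (refl , j≡0) =
      [ inj₁ ∘ via-weaken z≤n
      , [ inj₂ ∘ via-far (≤-reflexive (cong (k ∸_) (sym j≡0))) , inj₂ ∘ m<n⇒m<1+n ] ]
    reach-forward {inj₂ i} {inj₂ j} i+1≡j =
      Sum.map (via-weaken (s≤s (≤-trans (n≤1+n _) (≤-trans (≤-reflexive i+1≡j) (n≤1+n _)))))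
        (Sum.map (via-weaken (subst (λ n → k ∸ toℕ i ≤ suc (k ∸ n)) i+1≡j (∸-≤-suc-∸-suc k (toℕ i))))
                 m<n⇒m<1+n)
    reach-forward {inj₂ j} {inj₁ _} (refl , j+1≡k) =
      [ inj₂ ∘ inj₁ ∘ via-weaken (≤-reflexive (trans (cong (_∸ toℕ j) (sym j+1≡k)) (m+n∸n≡m 1 (toℕ j))))
      , inj₂ ∘ inj₂ ∘ m<n⇒m<1+n ]

    reach-backward : ∀ {x y d} → y ⇢ x → Reach y d → Reach x (suc d)
    reach-backward {inj₁ _} {inj₁ _} (k≡0 , _) _ = inj₂ (k≡0⇒k< k≡0)
    reach-backward {inj₂ j} {inj₁ _} (refl , j≡0) =
      [ inj₁ ∘ via-weaken (≤-reflexive (cong suc j≡0)) , inj₂ ∘ inj₂ ∘ m<n⇒m<1+n ]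
    reach-backward {inj₂ j} {inj₂ i} i+1≡j =
      Sum.map (via-weaken (≤-reflexive (cong suc (sym i+1≡j))))
        (Sum.map (via-weaken (≤-trans (∸-monoʳ-≤ k (≤-trans (n≤1+n _) (≤-reflexive i+1≡j))) (n≤1+n _)))
                 m<n⇒m<1+n)
    reach-backward {inj₁ _} {inj₂ j} (refl , j+1≡k) =
      [ inj₂ ∘ via-far (≤-reflexive (sym j+1≡k)) , [ inj₁ ∘ via-weaken z≤n , inj₂ ∘ m<n⇒m<1+n ] ]

    reach-step : ∀ {x y d} → x ≈ y → Reach y d → Reach x (suc d)
    reach-step (inj₁ x~y) = reach-old x~y
    reach-step (inj₂ (inj₁ x⇢y)) = reach-forward x⇢y
    reach-step (inj₂ (inj₂ y⇢x)) = reach-backward y⇢x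

    reach : ∀ {i d} → Walk graph i (encodeₑ (inj₁ t)) d → Reach (decodeₑ i) d
    reach here = subst (λ v → Reach v 0) (sym (decode-encodeₑ (inj₁ t))) (inj₁ (0 , z≤n , here))
    reach (step x≈y w) = reach-step x≈y (reach w)

  old-k-isometric : KIsometricEmbedding k base graph
  old-k-isometric = short-walks⇒k-isometric k old-embedding λ u v d w d≤k →
    case subst (λ x → Towards.Reach (decode v) x d) (decode-encodeₑ (inj₁ (decode u))) (Towards.reach (decode v) w)
    of λ where
      (inj₁ (d′ , d′≤d , w′)) →
        d′ , d′≤d , subst₂ (λ x y → Walk base x y d′) (encode-decode u) (encode-decode v) w′
      (inj₂ k<d) → contradiction (≤-trans k<d d≤k) 1+n≰n

injective-disjoint⇒+≤ : ∀ {m₁ m₂ n} (f : Fin m₁ → Fin n) (g : Fin m₂ → Fin n) →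
                        Injective _≡_ _≡_ f → Injective _≡_ _≡_ g → (∀ i j → f i ≢ g j) → m₁ + m₂ ≤ n
injective-disjoint⇒+≤ {m₁} {m₂} f g f-inj g-inj disjoint =
  injective⇒≤ {f = [ f , g ] ∘ splitAt m₁} λ {x} {y} eq →
    trans (sym (join-splitAt m₁ m₂ x))
          (trans (cong (join m₁ m₂) ([f,g]-inj (splitAt m₁ x) (splitAt m₁ y) eq)) (join-splitAt m₁ m₂ y))
  where
  [f,g]-inj : ∀ s t → [ f , g ] s ≡ [ f , g ] t → s ≡ t
  [f,g]-inj (inj₁ i) (inj₁ j) eq = cong inj₁ (f-inj eq)
  [f,g]-inj (inj₁ i) (inj₂ j) eq = contradiction eq (disjoint i j)
  [f,g]-inj (inj₂ i) (inj₁ j) eq = contradiction (sym eq) (disjoint j i)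
  [f,g]-inj (inj₂ i) (inj₂ j) eq = cong inj₂ (g-inj eq)

injective-avoiding : ∀ {m n} (f : Fin (suc m) → Fin n) → Injective _≡_ _≡_ f →
                     {P : Fin n → Set} → (∀ y → Dec (P y)) → (∀ i j → P (f i) → P (f j) → i ≡ j) →
                     Σ (Fin m → Fin n) λ g → Injective _≡_ _≡_ g × (∀ i → ¬ P (g i))
injective-avoiding f f-inj P? at-most-one with any? (P? ∘ f)
... | yes (i₀ , Pfi₀) = f ∘ punchIn i₀ , punchIn-injective i₀ _ _ ∘ f-inj ,
                        λ i Pfi → punchInᵢ≢i i₀ i (at-most-one _ _ Pfi Pfi₀)
... | no ∄ = f ∘ fsuc , suc-injectiveᶠ ∘ f-inj , λ i Pfi → ∄ (fsuc i , Pfi)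

injective⇒surjective : ∀ {m n} (f : Fin m → Fin n) → Injective _≡_ _≡_ f → n ≤ m →
                       ∀ y → ∃ λ x → f x ≡ y
injective⇒surjective {m} {suc n} f f-inj n<m y with any? (λ x → f x ≟ y)
... | yes found = found
... | no ∄ = contradiction (≤-trans n<m (injective⇒≤ {f = f′} f′-inj)) 1+n≰n
  where
  y≢f : ∀ x → y ≢ f x
  y≢f x y≡fx = ∄ (x , sym y≡fx)
  f′ : Fin m → Fin n
  f′ x = punchOut (y≢f x)
  f′-inj : Injective _≡_ _≡_ f′
  f′-inj eq = f-inj (punchOut-injective (y≢f _) (y≢f _) eq)

module ImageNeighbours {H U : Graph} (U-acyclic : Acyclic U) (H-connected : Connected H) (e : SubgraphEmbedding H U)
  where
  private
    F : Fin (size H) → Fin (size U)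
    F = map e

  InImage : Fin (size U) → Set
  InImage y = ∃ λ x → F x ≡ y

  AtMostOneNeighbourInImage : Fin (size U) → Set
  AtMostOneNeighbourInImage h = ∀ {a b} → Adj U h (F a) → Adj U h (F b) → a ≡ b

  outside⇒at-most-one-neighbour : ∀ {h} → ¬ InImage h → AtMostOneNeighbourInImage h
  outside⇒at-most-one-neighbour h∉ {a} {b} ha hb =
    inj e (acyclic⇒joined-neighbours-≡ U-acyclic ha hb (embedʷ e w) (h∉ ∘ in-image))
    where
    w : Walk H a b (proj₁ (H-connected a b))
    w = proj₂ (H-connected a b)
    in-image : ∀ {h} → h ∈ʷ embedʷ e w → InImage h
    in-image h∈ with y , _ , Fy≡h ← ∈ʷ-map⁻ F (hom e) w h∈ = y , Fy≡h

  leaf-path-neighbour : ∀ {w π a} → (∀ z → Adj H z w → z ≡ π) → Adj U (F w) (F a) →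
                        (r : Walk H a w d) → IsPath r → a ≡ π
  leaf-path-neighbour leaf Fw~Fa here _ = contradiction Fw~Fa (Adj-irrefl U)
  leaf-path-neighbour leaf Fw~Fa (step a~w here) _ = leaf _ a~w
  leaf-path-neighbour leaf Fw~Fa r@(step _ (step _ _)) r-path =
    contradiction (closed-path⇒cycle (embedʷ e r) (embedʷ-isPath e r r-path) Fw~Fa) (U-acyclic _)

  leaf⇒at-most-one-neighbour : ∀ {w π} → (∀ z → Adj H z w → z ≡ π) → AtMostOneNeighbourInImage (F w)
  leaf⇒at-most-one-neighbour {w} {π} leaf {a} {b} wa wb = trans (towards-parent wa) (sym (towards-parent wb))
    where
    towards-parent : ∀ {a} → Adj U (F w) (F a) → a ≡ π
    towards-parent {a} Fw~Fa with r ← walk⇒path (proj₂ (H-connected a w)) =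
      leaf-path-neighbour leaf Fw~Fa (PathIn.path r) (PathIn.isPath r)

  -- All but one of the neighbours of h lie outside the image of H.
  neighbours⇒size-bound : ∀ {h m} → Neighbours U h (suc m) → AtMostOneNeighbourInImage h →
                          size H + m ≤ size U
  neighbours⇒size-bound {h} (nb , nb-inj , nb-adj) one =
    let g , g-inj , g-out = injective-avoiding nb nb-inj (λ y → any? (λ x → F x ≟ y)) unique
    in injective-disjoint⇒+≤ F g (inj e) g-inj λ i j Fi≡gj → g-out j (i , Fi≡gj)
    where
    unique : ∀ i j → InImage (nb i) → InImage (nb j) → i ≡ j
    unique i j (a , Fa≡) (b , Fb≡) = nb-inj (trans (sym Fa≡) (trans (cong F a≡b) Fb≡))
      where
      a≡b : a ≡ b
      a≡b = one (subst (Adj U h) (sym Fa≡) (nb-adj i)) (subst (Adj U h) (sym Fb≡) (nb-adj j))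

Least : ∀ {a} → (ℕ → Set a) → Set a
Least P = ∃ λ m → P m × ∀ {m′} → m′ < m → ¬ P m′

¬¬-least : ∀ {a} {P : ℕ → Set a} n → P n → ¬ ¬ Least P
¬¬-least {P = P} = <-rec (λ n → P n → ¬ ¬ Least P) λ n smaller Pn no-least →
  ¬¬-excluded-middle {A = ∃ λ m → m < n × P m} λ where
    (yes (m , m<n , Pm)) → smaller m<n Pm no-least
    (no ∄) → no-least (n , Pn , λ m<n Pm → ∄ (_ , m<n , Pm))

¬¬-∀Fin : ∀ {a} n {P : Fin n → Set a} → (∀ i → ¬ ¬ P i) → ¬ ¬ (∀ i → P i)
¬¬-∀Fin zero _ none = none λ ()
¬¬-∀Fin (suc n) ¬¬P none = ¬¬P fzero λ P₀ → ¬¬-∀Fin n (¬¬P ∘ fsuc) λ Pₛ → none λ where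
  fzero → P₀
  (fsuc i) → Pₛ i

¬¬-decidable-adjacency : ∀ G → ¬ ¬ (∀ x y → Dec (Adj G x y))
¬¬-decidable-adjacency G = ¬¬-∀Fin _ λ x → ¬¬-∀Fin _ λ y → ¬¬-excluded-middle

indicator : ∀ {A : Set} → Dec A → ℕ
indicator (yes _) = 1
indicator (no _) = 0

indicator-mono : ∀ {A B : Set} → (A → B) → (A? : Dec A) (B? : Dec B) → indicator A? ≤ indicator B?
indicator-mono A⇒B (yes a) (yes _) = ≤-refl
indicator-mono A⇒B (yes a) (no ¬b) = contradiction (A⇒B a) ¬b
indicator-mono A⇒B (no _) _ = z≤n

indicator-< : ∀ {A B : Set} → B → ¬ A → (A? : Dec A) (B? : Dec B) → indicator A? < indicator B?
indicator-< b ¬a (yes a) _ = contradiction a ¬a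
indicator-< b ¬a (no _) (yes _) = s≤s z≤n
indicator-< b ¬a (no _) (no ¬b) = contradiction b ¬b

sum-mono : ∀ {n} {f g : Fin n → ℕ} → (∀ i → f i ≤ g i) → sum f ≤ sum g
sum-mono {zero} _ = z≤n
sum-mono {suc n} f≤g = +-mono-≤ (f≤g fzero) (sum-mono (f≤g ∘ fsuc))

sum-< : ∀ {n} {f g : Fin n → ℕ} → (∀ i → f i ≤ g i) → ∀ i → f i < g i → sum f < sum g
sum-< {suc n} f≤g fzero f<g = +-mono-<-≤ f<g (sum-mono (f≤g ∘ fsuc))
sum-< {suc n} f≤g (fsuc i) f<g = +-mono-≤-< (f≤g fzero) (sum-< (f≤g ∘ fsuc) i f<g)

pairCount : ∀ {n} {R : Fin n → Fin n → Set} → (∀ x y → Dec (R x y)) → ℕ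
pairCount R? = sum λ x → sum λ y → indicator (R? x y)

pairCount-< : ∀ {n} {R S : Fin n → Fin n → Set} (R? : ∀ x y → Dec (R x y)) (S? : ∀ x y → Dec (S x y)) →
              (∀ {x y} → R x y → S x y) → ∀ {x₀ y₀} → S x₀ y₀ → ¬ R x₀ y₀ →
              pairCount R? < pairCount S?
pairCount-< R? S? R⊆S {x₀} {y₀} s ¬r =
  sum-< (λ x → sum-mono λ y → indicator-mono R⊆S (R? x y) (S? x y)) x₀
    (sum-< (λ y → indicator-mono R⊆S (R? x₀ y) (S? x₀ y)) y₀ (indicator-< s ¬r (R? x₀ y₀) (S? x₀ y₀)))

-- A proper subgraph of a minimum graph has the same vertices, so it misses an edge.
module Relabel {S U : Graph} (e : SubgraphEmbedding S U) (onto : ∀ y → ∃ λ x → map e x ≡ y) where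

  back : Fin (size U) → Fin (size S)
  back = proj₁ ∘ onto

  map-back : ∀ y → map e (back y) ≡ y
  map-back = proj₂ ∘ onto

  back-map : ∀ x → back (map e x) ≡ x
  back-map x = inj e (map-back (map e x))

  relabelled : Graph
  relabelled = record
    { size = size U ; Adj = λ x y → Adj S (back x) (back y) ; sym = Adj-sym S ; irrefl = Adj-irrefl S }

  relabelled-⊆ : ∀ {x y} → Adj relabelled x y → Adj U x y
  relabelled-⊆ a = subst₂ (Adj U) (map-back _) (map-back _) (hom e a)

  relabelled-transport : ∀ {k T} → KIsometricEmbedding k T S → KIsometricEmbedding k T relabelled
  relabelled-transport =
    isometric-transport (map e) back (subst₂ (Adj S) (sym (back-map _)) (sym (back-map _))) id back-map

  proper⇒missing-edge : Proper e → ¬ (∀ x y → Adj U x y → Adj relabelled x y)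
  proper⇒missing-edge proper all-edges =
    proper ( (λ y → back y , λ { refl → map-back y })
           , λ x y a → back x , back y , map-back x , map-back y , all-edges x y a )

-- Extremal graphs are obtained classically, under ¬ ¬; this suffices to refute TreeUniversalityFrom.
module Extremal (k : ℕ) (T₁ T₂ : Graph) where

  Universal : Graph → Set
  Universal = UniversalPair k T₁ T₂

  ¬¬minimum : ∀ W → Universal W → ¬ ¬ Σ Graph (MinimumUniversalPair k T₁ T₂)
  ¬¬minimum W W-univ none =
    ¬¬-least {P = λ m → Σ Graph λ U → Universal U × size U ≡ m} (size W) (W , W-univ , refl) λ where
      (_ , (U , U-univ , refl) , least) →
        none (U , U-univ , λ U′ U′-univ → ≮⇒≥ λ lt → least lt (U′ , U′-univ , refl))

  CountedMinimum : ℕ → Set₁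
  CountedMinimum c =
    Σ Graph λ U → MinimumUniversalPair k T₁ T₂ U × Σ (∀ x y → Dec (Adj U x y)) λ U? → pairCount U? ≡ c

  fewest-edges⇒minimal : ∀ {c U} → MinimumUniversalPair k T₁ T₂ U →
                         (U? : ∀ x y → Dec (Adj U x y)) → pairCount U? ≡ c →
                         (∀ {c′} → c′ < c → ¬ CountedMinimum c′) → MinimalUniversalPair k T₁ T₂ U
  fewest-edges⇒minimal {U = U} (U-univ , U-min) U? refl fewest = U-univ , λ S e proper (S-univ₁ , S-univ₂) →
    let open Relabel e (injective⇒surjective (map e) (inj e) (U-min S (S-univ₁ , S-univ₂)))
    in ¬¬-decidable-adjacency relabelled λ R? → proper⇒missing-edge proper λ x y a →
         decidable-stable (R? x y) λ ¬r →
           fewest (pairCount-< R? U? relabelled-⊆ a ¬r)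
             (relabelled , ((relabelled-transport S-univ₁ , relabelled-transport S-univ₂) , U-min) , R? , refl)

  ¬¬minimum-minimal : ∀ W → Universal W →
                      ¬ ¬ Σ Graph λ U → MinimumUniversalPair k T₁ T₂ U × MinimalUniversalPair k T₁ T₂ U
  ¬¬minimum-minimal W W-univ none =
    ¬¬minimum W W-univ λ (U₀ , U₀-min) → ¬¬-decidable-adjacency U₀ λ U₀? →
      ¬¬-least {P = CountedMinimum} _ (U₀ , U₀-min , U₀? , refl) λ where
        (_ , (U , U-min , U? , count≡) , fewest) →
          none (U , U-min , fewest-edges⇒minimal U-min U? count≡ fewest)

clamp : ∀ p → ℕ → Fin (suc p)
clamp p zero = fzero
clamp zero (suc n) = fzero
clamp (suc p) (suc n) = fsuc (clamp p n)

clamp-toℕ : ∀ {p} (i : Fin (suc p)) → clamp p (toℕ i) ≡ i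
clamp-toℕ fzero = refl
clamp-toℕ {suc p} (fsuc i) = cong fsuc (clamp-toℕ i)

clamp-≥ : ∀ {p n} → p ≤ n → clamp p n ≡ fromℕ p
clamp-≥ {zero} {zero} _ = refl
clamp-≥ {zero} {suc n} _ = refl
clamp-≥ {suc p} {suc n} (s≤s p≤n) = cong fsuc (clamp-≥ p≤n)

clamp-step : ∀ p n → clamp p n ≡ clamp p (suc n) ⊎ suc (toℕ (clamp p n)) ≡ toℕ (clamp p (suc n))
clamp-step zero zero = inj₁ refl
clamp-step zero (suc n) = inj₁ refl
clamp-step (suc p) zero = inj₂ refl
clamp-step (suc p) (suc n) = Sum.map (cong fsuc) (cong suc) (clamp-step p n)

-- The spine is a path of length p = suc q; each of its two ends carries ℓ pendant leaves.
module DoubleBroom (q ℓ : ℕ) where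

  p : ℕ
  p = suc q

  Vertex : Set
  Vertex = Fin (suc p) ⊎ (Fin ℓ ⊎ Fin ℓ)

  infix 4 _⟶_ _~_

  _⟶_ : Vertex → Vertex → Set
  inj₁ i ⟶ inj₁ j = suc (toℕ i) ≡ toℕ j
  inj₁ i ⟶ inj₂ (inj₁ _) = toℕ i ≡ 0
  inj₁ i ⟶ inj₂ (inj₂ _) = toℕ i ≡ p
  inj₂ _ ⟶ _ = ⊥

  _~_ : Vertex → Vertex → Set
  x ~ y = x ⟶ y ⊎ y ⟶ x

  level : Vertex → ℕ
  level (inj₁ i) = toℕ i
  level (inj₂ (inj₁ _)) = 1
  level (inj₂ (inj₂ _)) = suc p

  parent : Vertex → Vertex
  parent (inj₁ i) = inj₁ (pred i)
  parent (inj₂ (inj₁ _)) = inj₁ fzero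
  parent (inj₂ (inj₂ _)) = inj₁ (fromℕ p)

  ⟶-child : ∀ {x y} → x ⟶ y → level y ≡ suc (level x) × parent y ≡ x
  ⟶-child {inj₁ i} {inj₁ (fsuc j)} eq =
    sym eq , cong inj₁ (toℕ-injective (trans (toℕ-inject₁ j) (sym (suc-injective eq))))
  ⟶-child {inj₁ i} {inj₂ (inj₁ _)} eq = cong suc (sym eq) , cong inj₁ (toℕ-injective (sym eq))
  ⟶-child {inj₁ i} {inj₂ (inj₂ _)} eq =
    cong suc (sym eq) , cong inj₁ (toℕ-injective (trans (toℕ-fromℕ p) (sym eq)))

  ⟶-irrefl : ∀ {x} → ¬ x ⟶ x
  ⟶-irrefl {inj₁ i} eq = 1+n≢n eq

  opaque
    coding : Vertex ↔ Fin (suc p + (ℓ + ℓ))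
    coding = ↔-sym (↔-trans +↔⊎ (↔-refl ⊎-↔ +↔⊎))

  presented : PresentedGraph
  presented = record
    { Vertex = Vertex ; order = suc p + (ℓ + ℓ) ; coding = coding
    ; _~_ = _~_ ; ~-sym = Sum.swap ; ~-irrefl = [ ⟶-irrefl , ⟶-irrefl ] }

  open PresentedGraph presented public using (graph; encode; decode; encode-adj; decode-encode; encode-decode)

  spine : Fin (suc p) → Fin (size graph)
  spine i = encode (inj₁ i)


  broom-layering : Layering graph
  broom-layering = PresentedGraph.layering presented level parent [ inj₁ ∘ ⟶-child , inj₂ ∘ ⟶-child ]

  acyclic : Acyclic graph
  acyclic = layering⇒acyclic broom-layering

  hub-distance : ∀ {d} → Walk graph (spine fzero) (spine (fromℕ p)) d → p ≤ d
  hub-distance {d} w = subst (_≤ d) (toℕ-fromℕ p)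
    (subst₂ (λ x y → level x ≤ level y + d) (decode-encode (inj₁ (fromℕ p))) (decode-encode (inj₁ fzero))
      (layering-walk-bound broom-layering w))

  spine-step : ∀ n → spine (clamp p n) ≡ spine (clamp p (suc n))
                   ⊎ Adj graph (spine (clamp p n)) (spine (clamp p (suc n)))
  spine-step n = Sum.map (cong spine) (encode-adj ∘ inj₁) (clamp-step p n)

  upward-spine-walk : ∀ i j → toℕ i ≤ toℕ j → Walk≤ graph (spine i) (spine j) p
  upward-spine-walk i j i≤j =
    subst₂ (λ x y → Walk≤ graph (spine x) (spine y) p)
      (clamp-toℕ i) (trans (cong (clamp p) (m∸n+n≡m i≤j)) (clamp-toℕ j))
      (Walk≤-weaken (≤-trans (m∸n≤m (toℕ j) (toℕ i)) (toℕ≤pred[n] j))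
        (stepwise-walk (spine ∘ clamp p) spine-step (toℕ i) (toℕ j ∸ toℕ i)))

  spine-walk : ∀ i j → Walk≤ graph (spine i) (spine j) p
  spine-walk i j with ≤-total (toℕ i) (toℕ j)
  ... | inj₁ i≤j = upward-spine-walk i j i≤j
  ... | inj₂ j≤i = reverse≤ (upward-spine-walk j i j≤i)

  walk-to-root : ∀ x → ∃ λ d → Walk graph (encode x) (spine fzero) d
  walk-to-root (inj₁ i) = _ , proj₂ (proj₂ (spine-walk i fzero))
  walk-to-root (inj₂ (inj₁ _)) = _ , step (encode-adj (inj₂ refl)) here
  walk-to-root (inj₂ (inj₂ _)) =
    _ , step (encode-adj (inj₂ (toℕ-fromℕ p))) (proj₂ (proj₂ (spine-walk (fromℕ p) fzero)))

  connected : Connected graph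
  connected u v with d₁ , p₁ ← walk-to-root (decode u) | d₂ , p₂ ← walk-to-root (decode v) =
    _ , subst₂ (λ x y → Walk graph x y _) (encode-decode u) (encode-decode v) (p₁ ++ʷ reverseʷ p₂)

  isTree : IsTree graph
  isTree = s≤s z≤n , connected , acyclic

  hub-path : Σ ℕ λ m → p ≤ m × Σ (Walk graph (spine fzero) (spine (fromℕ p)) m) IsPath
  hub-path with r ← walk⇒path (proj₂ (connected (spine fzero) (spine (fromℕ p)))) =
    PathIn.length r , hub-distance (PathIn.path r) , PathIn.path r , PathIn.isPath r

  leaf-parent : ∀ t {z} → z ~ inj₂ t → z ≡ parent (inj₂ t)
  leaf-parent t (inj₁ z⟶t) = sym (proj₂ (⟶-child z⟶t))

  spine-or-leaf : ∀ x → (∃ λ i → x ≡ spine i) ⊎ (∃ λ π → ∀ z → Adj graph z x → z ≡ π)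
  spine-or-leaf x with decode x in eq
  ... | inj₁ i = inj₁ (i , trans (sym (encode-decode x)) (cong encode eq))
  ... | inj₂ t = inj₂ (encode (parent (inj₂ t)) , λ z a →
          trans (sym (encode-decode z)) (cong encode (leaf-parent t a)))

  neighbours₀ neighbours₁ : Fin (suc ℓ) → Vertex
  neighbours₀ fzero = inj₁ (fsuc fzero)
  neighbours₀ (fsuc t) = inj₂ (inj₁ t)
  neighbours₁ fzero = inj₁ (inject₁ (fromℕ q))
  neighbours₁ (fsuc t) = inj₂ (inj₂ t)

  hub₀-neighbours : Neighbours graph (spine fzero) (suc ℓ)
  hub₀-neighbours = PresentedGraph.encode-neighbours presented neighbours₀ injective adjacent
    where
    injective : Injective _≡_ _≡_ neighbours₀
    injective {fzero} {fzero} _ = refl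
    injective {fsuc _} {fsuc _} refl = refl
    adjacent : ∀ i → inj₁ fzero ~ neighbours₀ i
    adjacent fzero = inj₁ refl
    adjacent (fsuc _) = inj₁ refl

  hub₁-neighbours : Neighbours graph (spine (fromℕ p)) (suc ℓ)
  hub₁-neighbours = PresentedGraph.encode-neighbours presented neighbours₁ injective adjacent
    where
    injective : Injective _≡_ _≡_ neighbours₁
    injective {fzero} {fzero} _ = refl
    injective {fsuc _} {fsuc _} refl = refl
    adjacent : ∀ i → inj₁ (fromℕ p) ~ neighbours₁ i
    adjacent fzero = inj₂ (cong suc (toℕ-inject₁ (fromℕ q)))
    adjacent (fsuc _) = inj₁ (toℕ-fromℕ p)

module Counterexample (k : ℕ) where
  module T₁ = DoubleBroom k (suc (suc k))
  module T₂ = DoubleBroom (suc k) (suc (suc k))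

  hub₀ hub₁ : T₂.Vertex
  hub₀ = inj₁ fzero
  hub₁ = inj₁ (fromℕ (suc (suc k)))

  module W = Ear T₂.presented hub₀ hub₁ (λ ()) k

  onEar : ℕ → W.EarVertex
  onEar zero = inj₁ hub₀
  onEar (suc n) with n <? k
  ... | yes n<k = inj₂ (fromℕ< n<k)
  ... | no _ = inj₁ hub₁

  onEar-last : onEar (suc k) ≡ inj₁ hub₁
  onEar-last with k <? k
  ... | yes k<k = contradiction k<k (<-irrefl refl)
  ... | no _ = refl

  onEar-step : ∀ n → n ≤ k → onEar n W.⇢ onEar (suc n)
  onEar-step zero _ with 0 <? k
  ... | yes 0<k = refl , toℕ-fromℕ< 0<k
  ... | no 0≮k = n≤0⇒n≡0 (≮⇒≥ 0≮k) , refl , refl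
  onEar-step (suc n) n<k with n <? k | suc n <? k
  ... | yes n<k′ | yes n+1<k = trans (cong suc (toℕ-fromℕ< n<k′)) (sym (toℕ-fromℕ< n+1<k))
  ... | yes n<k′ | no n+1≮k = refl , trans (cong suc (toℕ-fromℕ< n<k′)) (≤-antisym n<k (≮⇒≥ n+1≮k))
  ... | no n≮k | _ = contradiction n<k n≮k

  φ : T₁.Vertex → W.EarVertex
  φ (inj₁ i) = onEar (toℕ i)
  φ (inj₂ leaf) = inj₁ (inj₂ leaf)

  φ-child : ∀ {x y} → x T₁.⟶ y → φ x W.≈ φ y
  φ-child {inj₁ i} {inj₁ j} i+1≡j =
    inj₂ (inj₁ (subst (λ n → onEar (toℕ i) W.⇢ onEar n) i+1≡j
      (onEar-step (toℕ i) (≤-pred (subst (_≤ suc k) (sym i+1≡j) (toℕ≤pred[n] j))))))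
  φ-child {inj₁ i} {inj₂ (inj₁ _)} i≡0 = subst (λ n → onEar n W.≈ _) (sym i≡0) (inj₁ (inj₁ refl))
  φ-child {inj₁ i} {inj₂ (inj₂ _)} i≡last =
    subst (λ n → onEar n W.≈ _) (sym i≡last) (subst (W._≈ _) (sym onEar-last) (inj₁ (inj₁ (toℕ-fromℕ _))))

  φ-hom : ∀ {x y} → x T₁.~ y → φ x W.≈ φ y
  φ-hom = [ φ-child , W.≈-sym ∘ φ-child ]

  ρ : W.EarVertex → T₁.Vertex
  ρ (inj₁ (inj₁ i)) = inj₁ (clamp (suc k) (toℕ i))
  ρ (inj₁ (inj₂ leaf)) = inj₂ leaf
  ρ (inj₂ j) = inj₁ (clamp (suc k) (suc (toℕ j)))

  ρ-hub₁ : ∀ {n} → suc k ≤ n → ρ (inj₁ hub₁) ≡ inj₁ (clamp (suc k) n)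
  ρ-hub₁ k<n =
    cong inj₁ (trans (clamp-≥ (≤-trans (n≤1+n _) (≤-reflexive (sym (toℕ-fromℕ _))))) (sym (clamp-≥ k<n)))

  ρ-onEar : ∀ n → ρ (onEar n) ≡ inj₁ (clamp (suc k) n)
  ρ-onEar zero = refl
  ρ-onEar (suc n) with n <? k
  ... | yes n<k = cong (λ m → inj₁ (clamp (suc k) (suc m))) (toℕ-fromℕ< n<k)
  ... | no n≮k = ρ-hub₁ (s≤s (≮⇒≥ n≮k))

  ρ∘φ≡id : ∀ x → ρ (φ x) ≡ x
  ρ∘φ≡id (inj₁ i) = trans (ρ-onEar (toℕ i)) (cong inj₁ (clamp-toℕ i))
  ρ∘φ≡id (inj₂ _) = refl

  Near : T₁.Vertex → T₁.Vertex → Set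
  Near x y = x ≡ y ⊎ x T₁.~ y

  Near-sym : ∀ {x y} → Near x y → Near y x
  Near-sym = Sum.map sym Sum.swap

  clamp-near : ∀ m n → suc m ≡ n → Near (inj₁ (clamp (suc k) m)) (inj₁ (clamp (suc k) n))
  clamp-near m _ refl = Sum.map (cong inj₁) inj₁ (clamp-step (suc k) m)

  ρ-old-child : ∀ {x y} → x T₂.⟶ y → Near (ρ (inj₁ x)) (ρ (inj₁ y))
  ρ-old-child {inj₁ i} {inj₁ j} i+1≡j = clamp-near (toℕ i) (toℕ j) i+1≡j
  ρ-old-child {inj₁ i} {inj₂ (inj₁ _)} i≡0 = inj₂ (inj₁ (cong (toℕ ∘ clamp (suc k)) i≡0))
  ρ-old-child {inj₁ i} {inj₂ (inj₂ _)} i≡last =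
    inj₂ (inj₁ (trans (cong toℕ (clamp-≥ (≤-trans (n≤1+n _) (≤-reflexive (sym i≡last))))) (toℕ-fromℕ _)))

  ρ-forward : ∀ {x y} → x W.⇢ y → Near (ρ x) (ρ y)
  ρ-forward {inj₁ _} {inj₁ _} (k≡0 , refl , refl) =
    subst (Near (ρ (inj₁ hub₀))) (sym (ρ-hub₁ (s≤s (≤-reflexive k≡0)))) (clamp-near 0 1 refl)
  ρ-forward {inj₁ _} {inj₂ j} (refl , j≡0) = clamp-near 0 (suc (toℕ j)) (cong suc (sym j≡0))
  ρ-forward {inj₂ i} {inj₂ j} i+1≡j = clamp-near (suc (toℕ i)) (suc (toℕ j)) (cong suc i+1≡j)
  ρ-forward {inj₂ j} {inj₁ _} (refl , j+1≡k) =
    subst (Near (ρ (inj₂ j))) (sym (ρ-hub₁ (≤-reflexive (cong suc (sym j+1≡k)))))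
      (clamp-near (suc (toℕ j)) _ refl)

  ρ-weak : ∀ {x y} → x W.≈ y → Near (ρ x) (ρ y)
  ρ-weak {inj₁ _} {inj₁ _} (inj₁ x~y) = [ ρ-old-child , Near-sym ∘ ρ-old-child ] x~y
  ρ-weak (inj₂ (inj₁ x⇢y)) = ρ-forward x⇢y
  ρ-weak (inj₂ (inj₂ y⇢x)) = Near-sym (ρ-forward y⇢x)

  T₁-k-isometric : KIsometricEmbedding k T₁.graph W.graph
  T₁-k-isometric = presented-retraction⇒k-isometric T₁.presented W.presented k φ ρ φ-hom ρ-weak ρ∘φ≡id

  universal : UniversalPair k T₁.graph T₂.graph W.graph
  universal = T₁-k-isometric , W.old-k-isometric

  module _ {U : Graph} (U-acyclic : Acyclic U)
           (e₁ : SubgraphEmbedding T₁.graph U) (e₂ : SubgraphEmbedding T₂.graph U) where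
    open ImageNeighbours U-acyclic T₁.connected e₁
    private
      F₁ : Fin (size T₁.graph) → Fin (size U)
      F₁ = map e₁
      F₂ : Fin (size T₂.graph) → Fin (size U)
      F₂ = map e₂

    hubs-apart : ∀ i j → F₂ (T₂.spine fzero) ≡ F₁ (T₁.spine i) →
                 ¬ F₂ (T₂.spine (fromℕ _)) ≡ F₁ (T₁.spine j)
    hubs-apart i j eq₀ eq₁ with m , k+2≤m , r , r-path ← T₂.hub-path | d , d≤k+1 , w ← T₁.spine-walk i j =
      1+n≰n (≤-trans k+2≤m
        (≤-trans (acyclic⇒path-shortest U-acyclic (embedʷ e₂ r) (embedʷ-isPath e₂ r r-path) w′) d≤k+1))
      where
      w′ : Walk U (F₂ (T₂.spine fzero)) (F₂ (T₂.spine (fromℕ _))) d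
      w′ = subst₂ (λ x y → Walk U x y d) (sym eq₀) (sym eq₁) (embedʷ e₁ w)

    hub-case : ∀ h → AtMostOneNeighbourInImage (F₂ h) ⊎ ∃ λ i → F₂ h ≡ F₁ (T₁.spine i)
    hub-case h with any? (λ x → F₁ x ≟ F₂ h)
    ... | no ∉ = inj₁ (outside⇒at-most-one-neighbour ∉)
    ... | yes (w , Fw≡) with T₁.spine-or-leaf w
    ...   | inj₁ (i , w≡) = inj₂ (i , trans (sym Fw≡) (cong F₁ w≡))
    ...   | inj₂ (_ , leaf) = inj₁ (subst AtMostOneNeighbourInImage Fw≡ (leaf⇒at-most-one-neighbour leaf))

    tree-size-bound : size T₁.graph + suc (suc k) ≤ size U
    tree-size-bound with hub-case (T₂.spine fzero) | hub-case (T₂.spine (fromℕ _))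
    ... | inj₁ one | _ = neighbours⇒size-bound (embed-neighbours e₂ T₂.hub₀-neighbours) one
    ... | _ | inj₁ one = neighbours⇒size-bound (embed-neighbours e₂ T₂.hub₁-neighbours) one
    ... | inj₂ (i , eq₀) | inj₂ (j , eq₁) = contradiction eq₁ (hubs-apart i j eq₀)

  T₂-size : size T₂.graph ≡ 7 + k * 3
  T₂-size = arithmetic k
    where
    arithmetic : ∀ k → suc (suc (suc k)) + (suc (suc k) + suc (suc k)) ≡ 7 + k * 3
    arithmetic = solve-∀

  W-size : suc (size W.graph) ≡ size T₁.graph + suc (suc k)
  W-size = arithmetic k
    where
    arithmetic : ∀ k → suc (suc (suc (suc k)) + (suc (suc k) + suc (suc k)) + k)
                     ≡ suc (suc k) + (suc (suc k) + suc (suc k)) + suc (suc k)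
    arithmetic = solve-∀

  minimum-not-tree : ∀ U → MinimumUniversalPair k T₁.graph T₂.graph U → ¬ IsTree U
  minimum-not-tree U ((e₁ , e₂) , U-min) (_ , _ , U-acyclic) =
    1+n≰n (≤-trans (≤-reflexive W-size)
                   (≤-trans (tree-size-bound U-acyclic (proj₁ e₁) (proj₁ e₂)) (U-min W.graph universal)))

8+[n∸8]/3*3≤n : ∀ n → 8 ≤ n → 8 + (n ∸ 8) / 3 * 3 ≤ n
8+[n∸8]/3*3≤n n 8≤n = ≤-trans (+-monoʳ-≤ 8 (m/n*n≤m (n ∸ 8) 3)) (≤-reflexive (m+[n∸m]≡n 8≤n))

theorem7 : ∀ (n : ℕ) → 8 ≤ n →
    (Σ Graph λ T₁ → Σ Graph λ T₂ →
      IsTree T₁ × IsTree T₂ × size T₁ ≤ n × size T₂ ≤ n ×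
      (∀ U → MinimumUniversalPair ((n ∸ 8) / 3) T₁ T₂ U → ¬ IsTree U))
    × ¬ TreeUniversalityFrom n ((n ∸ 8) / 3)
theorem7 n 8≤n = (T₁.graph , T₂.graph , T₁.isTree , T₂.isTree , T₁≤n , T₂≤n , minimum-not-tree) , not-from-k
  where
  k : ℕ
  k = (n ∸ 8) / 3
  open Counterexample k

  T₂≤n : size T₂.graph ≤ n
  T₂≤n = subst (_≤ n) (sym T₂-size) (≤-trans (n≤1+n _) (8+[n∸8]/3*3≤n n 8≤n))

  T₁≤n : size T₁.graph ≤ n
  T₁≤n = ≤-trans (n≤1+n _) T₂≤n

  not-from-k : ¬ TreeUniversalityFrom n k
  not-from-k trees =
    Extremal.¬¬minimum-minimal k T₁.graph T₂.graph W.graph universal λ (U , U-min , U-minimal) →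
      minimum-not-tree U U-min
        (trees k ≤-refl T₁.graph T₂.graph T₁.isTree T₂.isTree T₁≤n T₂≤n U U-min U-minimal)
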